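{- Let $m\geq 2$ be an integer and let $y_1\leq y_2\leq\cdots\leq y_m$ be integers, all $\geq 2$, with $(y_1,\ldots,y_m)\notin\{(2,2),(2,3)\}$. Then there exist positive integers $k,Y$ such that, with $n=k+m+1$, the $n$-tuple $(\overline{1}_k,y_1,\ldots,y_m,Y)$ lies in $S(n)$. In particular, $$\limsup_{n\to+\infty}\ \max_{(x_1,\ldots,x_n)\in S(n)}|\{x_1,\ldots,x_n\}|=+\infty.$$
   Context: $\sigma_k$ denotes the $k$-th elementary symmetric polynomial in $n$ variables; $\overline{1}_k$ denotes $k$ consecutive entries equal to $1$. $S(n)$ is the set of $n$-tuples $(x_1,\ldots,x_n)$ of positive integers with $x_1\leq\cdots\leq x_n$ and $\sigma_2(x_1,\ldots,x_n)=\sigma_n(x_1,\ldots,x_n)$. $|\{x_1,\ldots,x_n\}|$ is the number of distinct entries. -}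

module Defs where

open import Data.Nat using (ℕ; zero; suc; _+_; _*_; _≤_; _≟_)
open import Data.List using (List; []; _∷_; length; deduplicate)
open import Data.List.Relation.Unary.All using (All)
open import Data.List.Relation.Unary.Linked using (Linked)
open import Data.Product using (_×_)
open import Relation.Binary.PropositionalEquality using (_≡_)

σ : ℕ → List ℕ → ℕ
σ zero    _        = 1
σ (suc k) []       = 0
σ (suc k) (x ∷ xs) = x * σ k xs + σ (suc k) xs

InS : ℕ → List ℕ → Set
InS n xs = (length xs ≡ n) × All (1 ≤_) xs × Linked _≤_ xs × (σ 2 xs ≡ σ n xs)

distinctCount : List ℕ → ℕ
distinctCount xs = length (deduplicate _≟_ xs)

{-# OPTIONS --safe #-}

-- For a nondecreasing tuple y of integers ≥ 2 with sum s and product P, pad it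
-- with k ones and one more entry Y.  Then σ₂ = T + k (s + Y) + σ₂(y) + s Y, where
-- T = σ₂(1,…,1), while σₙ = P Y.  Taking k = P − s − 1 and Y = T + k s + σ₂(y)
-- turns σ₂ = σₙ into (1 + k + s) Y = P Y, so it remains to show P ≥ s + 2.  This
-- fails only for the pairs (2,2) and (2,3); for longer tuples it follows from
-- x P ≥ x + s + 2 whenever x ≥ 2 and P ≥ max(s, 4).  Starting from
-- y = (3,4,…,m+2) yields tuples in S(n) with at least m distinct entries and n ≥ m.
module Submission where

open import Defs
open import Data.Nat using (ℕ; _+_; _≤_)
open import Data.List using (List; []; _∷_; _++_; length; replicate)
open import Data.List.Relation.Unary.All using (All)
open import Data.List.Relation.Unary.Linked using (Linked)
open import Data.Product using (_×_; ∃-syntax)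
open import Relation.Binary.PropositionalEquality using (_≡_; _≢_)

open import Level using (Level)
open import Data.Nat using (zero; suc; _*_; _^_; _<_; _≟_; s≤s; z≤n)
open import Data.Nat.Properties
open import Data.Nat.ListAction using (sum; product)
open import Data.Nat.ListAction.Properties using (sum-++; product-++)
open import Data.Nat.Tactic.RingSolver using (solve-∀)
open import Data.List using (applyUpTo; filter; deduplicate)
open import Data.List.Properties using (length-++; length-replicate; length-applyUpTo; filter-notAll)
open import Data.List.Relation.Unary.All as All using ([]; _∷_)
import Data.List.Relation.Unary.All.Properties as All
open import Data.List.Relation.Unary.Any as Any using (here; there)
open import Data.List.Relation.Unary.AllPairs using (_∷_)
open import Data.List.Relation.Unary.Linked using ([]; [-]; _∷_)
import Data.List.Relation.Unary.Linked.Properties as Linked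
open import Data.List.Relation.Unary.Unique.Propositional using (Unique)
import Data.List.Relation.Unary.Unique.Propositional.Properties as Unique
open import Data.List.Membership.Propositional.Properties using (∈-filter⁺; ∈-++⁺ˡ; ∈-++⁺ʳ; ∈-deduplicate⁺)
open import Data.List.Relation.Binary.Subset.Propositional using (_⊆_)
open import Data.Product using (_,_)
open import Data.Empty using (⊥-elim)
open import Relation.Binary.Core using (Rel)
open import Relation.Binary.Definitions using (Reflexive; DecidableEquality)
open import Relation.Binary.PropositionalEquality using (refl; sym; trans; cong; cong₂; module ≡-Reasoning)
open import Relation.Nullary using (¬?)
open import Relation.Unary using (Decidable)

private
  variable
    a ℓ : Level
    A : Set a

σ-length< : ∀ {k} xs → length xs < k → σ k xs ≡ 0
σ-length< {suc k} []       _             = refl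
σ-length< {suc k} (x ∷ xs) (s≤s len<k)
  rewrite σ-length< xs len<k | σ-length< xs (m<n⇒m<1+n len<k) | *-zeroʳ x = refl

σ-length≡product : ∀ xs → σ (length xs) xs ≡ product xs
σ-length≡product []       = refl
σ-length≡product (x ∷ xs) = begin
  x * σ (length xs) xs + σ (suc (length xs)) xs
    ≡⟨ cong₂ _+_ (cong (x *_) (σ-length≡product xs)) (σ-length< xs ≤-refl) ⟩
  x * product xs + 0
    ≡⟨ +-identityʳ _ ⟩
  x * product xs ∎
  where open ≡-Reasoning

σ-1≡sum : ∀ xs → σ 1 xs ≡ sum xs
σ-1≡sum []       = refl
σ-1≡sum (x ∷ xs) = cong₂ _+_ (*-identityʳ x) (σ-1≡sum xs)

σ-2-++ : ∀ xs ys → σ 2 (xs ++ ys) ≡ σ 2 xs + sum xs * sum ys + σ 2 ys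
σ-2-++ []       ys = refl
σ-2-++ (x ∷ xs) ys = begin
  x * σ 1 (xs ++ ys) + σ 2 (xs ++ ys)
    ≡⟨ cong₂ _+_ (cong (x *_) (trans (σ-1≡sum (xs ++ ys)) (sum-++ xs ys))) (σ-2-++ xs ys) ⟩
  x * (sum xs + sum ys) + (σ 2 xs + sum xs * sum ys + σ 2 ys)
    ≡⟨ regroup x (sum xs) (sum ys) (σ 2 xs) (σ 2 ys) ⟩
  x * sum xs + σ 2 xs + (x + sum xs) * sum ys + σ 2 ys
    ≡⟨ cong (λ t → x * t + σ 2 xs + (x + sum xs) * sum ys + σ 2 ys) (sym (σ-1≡sum xs)) ⟩
  x * σ 1 xs + σ 2 xs + (x + sum xs) * sum ys + σ 2 ys ∎
  where
  open ≡-Reasoning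
  regroup : ∀ x s t e f → x * (s + t) + (e + s * t + f) ≡ x * s + e + (x + s) * t + f
  regroup = solve-∀

sum-replicate : ∀ n x → sum (replicate n x) ≡ n * x
sum-replicate zero    x = refl
sum-replicate (suc n) x = cong (x +_) (sum-replicate n x)

product-replicate : ∀ n x → product (replicate n x) ≡ x ^ n
product-replicate zero    x = refl
product-replicate (suc n) x = cong (x *_) (product-replicate n x)

All-≤-sum : ∀ xs → All (_≤ sum xs) xs
All-≤-sum []       = []
All-≤-sum (x ∷ xs) = m≤m+n x (sum xs) ∷ All.map (λ p → ≤-trans p (m≤n+m _ x)) (All-≤-sum xs)

module _ {R : Rel A ℓ} where

  replicate-++⁺ : Reflexive R → ∀ n {x ys} → All (R x) ys → Linked R ys → Linked R (replicate n x ++ ys)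
  replicate-++⁺ refl′ zero          _         Rys = Rys
  replicate-++⁺ refl′ (suc zero)    []        _   = [-]
  replicate-++⁺ refl′ (suc zero)    (Rxy ∷ _) Rys = Rxy ∷ Rys
  replicate-++⁺ refl′ (suc (suc n)) Rxys      Rys = refl′ ∷ replicate-++⁺ refl′ (suc n) Rxys Rys

  ∷ʳ⁺ : ∀ {xs y} → All (λ x → R x y) xs → Linked R xs → Linked R (xs ++ y ∷ [])
  ∷ʳ⁺ []              []          = [-]
  ∷ʳ⁺ (Rxy ∷ [])      [-]         = Rxy ∷ [-]
  ∷ʳ⁺ (_ ∷ Rxsy)      (Rxx′ ∷ Rxs) = Rxx′ ∷ ∷ʳ⁺ Rxsy Rxs

Unique-⊆⇒length≤ : DecidableEquality A → ∀ {xs ys : List A} → Unique xs → xs ⊆ ys → length xs ≤ length ys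
Unique-⊆⇒length≤ _≟_ {[]}     _              _      = z≤n
Unique-⊆⇒length≤ _≟_ {x ∷ xs} {ys} (x∉xs ∷ xs-uniq) x∷xs⊆ys =
  ≤-trans (s≤s (Unique-⊆⇒length≤ _≟_ xs-uniq xs⊆ys-x))
          (filter-notAll x≢? ys (Any.map (λ x≡v x≢v → x≢v x≡v) (x∷xs⊆ys (here refl))))
  where
  x≢? : Decidable (x ≢_)
  x≢? v = ¬? (x ≟ v)
  xs⊆ys-x : xs ⊆ filter x≢? ys
  xs⊆ys-x v∈xs = ∈-filter⁺ x≢? (x∷xs⊆ys (there v∈xs)) (All.lookup x∉xs v∈xs)

m+k≡n⇒m≤n : ∀ {m n} k → m + k ≡ n → m ≤ n
m+k≡n⇒m≤n k refl = m≤m+n _ k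

x+s≤x*P : ∀ {x s P} → 2 ≤ x → s ≤ P → 2 ≤ P → x + s ≤ x * P
x+s≤x*P {suc (suc a)} {s} {P} (s≤s (s≤s _)) s≤P 2≤P = begin
  2 + a + s         ≡⟨ +-comm (2 + a) s ⟩
  s + (2 + a)       ≤⟨ +-monoʳ-≤ s (+-monoʳ-≤ 2 (m≤m*n a 2)) ⟩
  s + suc a * 2     ≤⟨ +-mono-≤ s≤P (*-monoʳ-≤ (suc a) 2≤P) ⟩
  P + suc a * P     ∎
  where open ≤-Reasoning

2+x+s≤x*P : ∀ {x s P} → 2 ≤ x → s ≤ P → 4 ≤ P → 2 + x + s ≤ x * P
2+x+s≤x*P {suc (suc a)} {s} {P} (s≤s (s≤s _)) s≤P 4≤P = begin
  2 + (2 + a) + s     ≡⟨ +-comm (2 + (2 + a)) s ⟩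
  s + (4 + a)         ≤⟨ +-monoʳ-≤ s (+-monoʳ-≤ 4 (m≤m*n a 4)) ⟩
  s + suc a * 4       ≤⟨ +-mono-≤ s≤P (*-monoʳ-≤ (suc a) 4≤P) ⟩
  P + suc a * P       ∎
  where open ≤-Reasoning

m^length≤product : ∀ {m} xs → All (m ≤_) xs → m ^ length xs ≤ product xs
m^length≤product []       []           = ≤-refl
m^length≤product (x ∷ xs) (m≤x ∷ m≤xs) = *-mono-≤ m≤x (m^length≤product xs m≤xs)

sum≤product : ∀ xs → 1 ≤ length xs → All (2 ≤_) xs → sum xs ≤ product xs
sum≤product (x ∷ [])           _ _             = ≤-reflexive (trans (+-identityʳ x) (sym (*-identityʳ x)))
sum≤product (x ∷ xs@(_ ∷ _))   _ (2≤x ∷ xs≥2) =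
  x+s≤x*P 2≤x (sum≤product xs (s≤s z≤n) xs≥2)
    (≤-trans (^-monoʳ-≤ 2 {1} {length xs} (s≤s z≤n)) (m^length≤product xs xs≥2))

2+sum≤product : ∀ xs → 2 ≤ length xs → All (2 ≤_) xs → Linked _≤_ xs → xs ≢ 2 ∷ 2 ∷ [] → xs ≢ 2 ∷ 3 ∷ [] →
                2 + sum xs ≤ product xs
2+sum≤product (_ ∷ []) (s≤s ()) _ _ _ _
2+sum≤product (a ∷ b ∷ []) _ (2≤a ∷ _) (a≤b ∷ [-]) ≢22 ≢23
  with m≤n⇒∃[o]m+o≡n 2≤a | m≤n⇒∃[o]m+o≡n a≤b
... | zero , refl  | zero , refl        = ⊥-elim (≢22 refl)
... | zero , refl  | suc zero , refl    = ⊥-elim (≢23 refl)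
... | zero , refl  | suc (suc j) , refl = m+k≡n⇒m≤n j (expand j)
  where
  expand : ∀ j → 2 + (2 + 0 + (2 + 0 + suc (suc j) + 0)) + j ≡ (2 + 0) * ((2 + 0 + suc (suc j)) * 1)
  expand = solve-∀
... | suc i , refl | j , refl           = m+k≡n⇒m≤n _ (expand i j)
  where
  expand : ∀ i j → 2 + (2 + suc i + (2 + suc i + j + 0)) + (1 + 4 * i + 2 * j + i * i + i * j)
                 ≡ (2 + suc i) * ((2 + suc i + j) * 1)
  expand = solve-∀
2+sum≤product (x ∷ xs@(_ ∷ _ ∷ _)) _ (2≤x ∷ xs≥2) _ _ _ =
  2+x+s≤x*P 2≤x (sum≤product xs (s≤s z≤n) xs≥2)
    (≤-trans (^-monoʳ-≤ 2 {2} {length xs} (s≤s (s≤s z≤n))) (m^length≤product xs xs≥2))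

completion : ℕ → List ℕ → ℕ → List ℕ
completion k y Y = replicate k 1 ++ y ++ Y ∷ []

closingEntry : ℕ → List ℕ → ℕ
closingEntry k y = σ 2 (replicate k 1) + k * sum y + σ 2 y

length-completion : ∀ k y Y → length (completion k y Y) ≡ k + length y + 1
length-completion k y Y = begin
  length (replicate k 1 ++ y ++ Y ∷ [])          ≡⟨ length-++ (replicate k 1) ⟩
  length (replicate k 1) + length (y ++ Y ∷ [])  ≡⟨ cong₂ _+_ (length-replicate k) (length-++ y) ⟩
  k + (length y + 1)                             ≡⟨ +-assoc k (length y) 1 ⟨
  k + length y + 1                               ∎
  where open ≡-Reasoning

σ₂-completion : ∀ k y Y → σ 2 (completion k y Y) ≡ closingEntry k y + (k + sum y) * Y
σ₂-completion k y Y = begin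
  σ 2 (replicate k 1 ++ y ++ Y ∷ [])
    ≡⟨ σ-2-++ (replicate k 1) (y ++ Y ∷ []) ⟩
  σ 2 (replicate k 1) + sum (replicate k 1) * sum (y ++ Y ∷ []) + σ 2 (y ++ Y ∷ [])
    ≡⟨ cong₂ (λ u v → σ 2 (replicate k 1) + u + v)
             (cong₂ _*_ (sum-replicate k 1) (sum-++ y (Y ∷ []))) (σ-2-++ y (Y ∷ [])) ⟩
  σ 2 (replicate k 1) + k * 1 * (sum y + (Y + 0)) + (σ 2 y + sum y * (Y + 0) + (Y * 0 + 0))
    ≡⟨ regroup (σ 2 (replicate k 1)) k (sum y) (σ 2 y) Y ⟩
  closingEntry k y + (k + sum y) * Y ∎
  where
  open ≡-Reasoning
  regroup : ∀ t k s e Y → t + k * 1 * (s + (Y + 0)) + (e + s * (Y + 0) + (Y * 0 + 0)) ≡ t + k * s + e + (k + s) * Y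
  regroup = solve-∀

product-completion : ∀ k y Y → product (completion k y Y) ≡ product y * Y
product-completion k y Y = begin
  product (replicate k 1 ++ y ++ Y ∷ [])               ≡⟨ product-++ (replicate k 1) (y ++ Y ∷ []) ⟩
  product (replicate k 1) * product (y ++ Y ∷ [])      ≡⟨ cong₂ _*_ (trans (product-replicate k 1) (^-zeroˡ k)) (product-++ y (Y ∷ [])) ⟩
  1 * (product y * (Y * 1))                            ≡⟨ *-identityˡ _ ⟩
  product y * (Y * 1)                                  ≡⟨ cong (product y *_) (*-identityʳ Y) ⟩
  product y * Y                                        ∎
  where open ≡-Reasoning

completion-σ₂≡σₙ : ∀ k y → suc (k + sum y) ≡ product y →
                   let L = completion k y (closingEntry k y) in σ 2 L ≡ σ (length L) L
completion-σ₂≡σₙ k y 1+k+s≡P = begin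
  σ 2 L                         ≡⟨ σ₂-completion k y Y ⟩
  Y + (k + sum y) * Y           ≡⟨⟩
  suc (k + sum y) * Y           ≡⟨ cong (_* Y) 1+k+s≡P ⟩
  product y * Y                 ≡⟨ product-completion k y Y ⟨
  product L                     ≡⟨ σ-length≡product L ⟨
  σ (length L) L                ∎
  where
  open ≡-Reasoning
  Y : ℕ
  Y = closingEntry k y
  L : List ℕ
  L = completion k y Y

sum≤closingEntry : ∀ {k} y → 1 ≤ k → sum y ≤ closingEntry k y
sum≤closingEntry {k@(suc _)} y _ =
  ≤-trans (m≤n*m (sum y) k) (≤-trans (m≤n+m _ (σ 2 (replicate k 1))) (m≤m+n _ (σ 2 y)))

1≤closingEntry : ∀ {k} y → 1 ≤ k → All (1 ≤_) y → suc (k + sum y) ≡ product y → 1 ≤ closingEntry k y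
1≤closingEntry {suc _} []      _   _          ()
1≤closingEntry         (a ∷ y) 1≤k (1≤a ∷ _) _ =
  ≤-trans 1≤a (≤-trans (m≤m+n a (sum y)) (sum≤closingEntry (a ∷ y) 1≤k))

completion-∈S : ∀ {k} y → 1 ≤ k → All (1 ≤_) y → Linked _≤_ y → suc (k + sum y) ≡ product y →
                InS (k + length y + 1) (completion k y (closingEntry k y))
completion-∈S {k} y 1≤k y≥1 y↑ 1+k+s≡P =
  length-completion k y Y ,
  All.++⁺ (All.replicate⁺ k ≤-refl) y++Y≥1 ,
  replicate-++⁺ ≤-refl k y++Y≥1 (∷ʳ⁺ y≤Y y↑) ,
  trans (completion-σ₂≡σₙ k y 1+k+s≡P) (cong (λ n → σ n (completion k y Y)) (length-completion k y Y))
  where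
  Y : ℕ
  Y = closingEntry k y
  y≤Y : All (_≤ Y) y
  y≤Y = All.map (λ a≤s → ≤-trans a≤s (sum≤closingEntry y 1≤k)) (All-≤-sum y)
  y++Y≥1 : All (1 ≤_) (y ++ Y ∷ [])
  y++Y≥1 = All.++⁺ y≥1 (1≤closingEntry y 1≤k y≥1 1+k+s≡P ∷ [])

∃-completion-∈S : (m : ℕ) → 2 ≤ m → (y : List ℕ) → length y ≡ m → All (2 ≤_) y → Linked _≤_ y →
            y ≢ 2 ∷ 2 ∷ [] → y ≢ 2 ∷ 3 ∷ [] →
            ∃[ k ] ∃[ Y ] (1 ≤ k × 1 ≤ Y × InS (k + m + 1) (replicate k 1 ++ y ++ Y ∷ []))
∃-completion-∈S _ 2≤m y refl y≥2 y↑ ≢22 ≢23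
  with d , 2+s+d≡P ← m≤n⇒∃[o]m+o≡n (2+sum≤product y 2≤m y≥2 y↑ ≢22 ≢23) =
  suc d , closingEntry (suc d) y , s≤s z≤n ,
  1≤closingEntry y (s≤s z≤n) y≥1 1+k+s≡P , completion-∈S y (s≤s z≤n) y≥1 y↑ 1+k+s≡P
  where
  y≥1 : All (1 ≤_) y
  y≥1 = All.map (≤-trans (s≤s z≤n)) y≥2
  1+k+s≡P : suc (suc d + sum y) ≡ product y
  1+k+s≡P = trans (cong (2 +_) (+-comm d (sum y))) 2+s+d≡P

∃-∈S-distinctCount≥ : ∀ j → ∃[ n ] (2 + j ≤ n × ∃[ xs ] (InS n xs × 2 + j ≤ distinctCount xs))
∃-∈S-distinctCount≥ j =
  let k , Y , _ , _ , xs∈S = ∃-completion-∈S m (s≤s (s≤s z≤n)) y (length-applyUpTo (3 +_) m) y≥2 y↑ (λ ()) (λ ())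
  in k + m + 1 , ≤-trans (m≤n+m m k) (m≤m+n _ 1) , _ , xs∈S ,
     ≤-trans (≤-reflexive (sym (length-applyUpTo (3 +_) m))) (Unique-⊆⇒length≤ _≟_ y-unique (y⊆ k Y))
  where
  m : ℕ
  m = 2 + j
  y : List ℕ
  y = applyUpTo (3 +_) m
  y≥2 : All (2 ≤_) y
  y≥2 = All.applyUpTo⁺₂ (3 +_) m (λ _ → s≤s (s≤s z≤n))
  y↑ : Linked _≤_ y
  y↑ = Linked.applyUpTo⁺₂ (3 +_) m (λ i → n≤1+n (3 + i))
  y-unique : Unique y
  y-unique = Unique.applyUpTo⁺₁ (3 +_) m (λ i<j _ → <⇒≢ (+-monoʳ-< 3 i<j))
  y⊆ : ∀ k Y → y ⊆ deduplicate _≟_ (replicate k 1 ++ y ++ Y ∷ [])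
  y⊆ k Y v∈y = ∈-deduplicate⁺ _≟_ (∈-++⁺ʳ (replicate k 1) (∈-++⁺ˡ v∈y))

theorem4p6 : ((m : ℕ) → 2 ≤ m → (y : List ℕ) → length y ≡ m → All (2 ≤_) y → Linked _≤_ y →
      y ≢ 2 ∷ 2 ∷ [] → y ≢ 2 ∷ 3 ∷ [] →
      ∃[ k ] ∃[ Y ] (1 ≤ k × 1 ≤ Y × InS (k + m + 1) (replicate k 1 ++ y ++ Y ∷ [])))
    × ((B N : ℕ) → ∃[ n ] (N ≤ n × ∃[ xs ] (InS n xs × B ≤ distinctCount xs)))
theorem4p6 = ∃-completion-∈S , unbounded
  where
  unbounded : (B N : ℕ) → ∃[ n ] (N ≤ n × ∃[ xs ] (InS n xs × B ≤ distinctCount xs))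
  unbounded B N =
    let n , 2+B+N≤n , xs , xs∈S , 2+B+N≤d = ∃-∈S-distinctCount≥ (B + N)
    in n , ≤-trans (≤-trans (m≤n+m N B) (m≤n+m _ 2)) 2+B+N≤n ,
       xs , xs∈S , ≤-trans (≤-trans (m≤m+n B N) (m≤n+m _ 2)) 2+B+N≤d
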